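{- For all integers $k,l\ge1$, the $2D$ infinite Fibonacci word $f_{\infty,\infty}$ has exactly $(k+1)(l+1)$ distinct factors of size $(k,l)$.
   Context: Alphabet $\{a,b,c,d\}$. The $2D$ infinite Fibonacci word $f_{\infty,\infty}=[f(i,j)]_{i,j\ge1}$ is the fixed point $\lim_{n\to\infty}\mu^n(d)$ of the $2D$ morphism $\mu$ given by $d\mapsto\begin{smallmatrix}d&c\\ b&a\end{smallmatrix}$, $c\mapsto\begin{smallmatrix}d\\ b\end{smallmatrix}$, $b\mapsto\begin{smallmatrix}d&c\end{smallmatrix}$, $a\mapsto d$. Equivalently, if $x=x_1x_2\cdots=101101011\cdots$ is the fixed point of $1\mapsto10,\ 0\mapsto1$, then $f(i,j)=d,c,b,a$ according as $(x_i,x_j)=(1,1),(1,0),(0,1),(0,0)$. A factor of size $(k,l)$ of $f_{\infty,\infty}$ is a $k\times l$ array ($k$ rows, $l$ columns) equal to the block of $f_{\infty,\infty}$ in rows $i+1,\dots,i+k$ and columns $j+1,\dots,j+l$ for some $i,j\ge0$. -}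

module Defs where

open import Data.Nat using (ℕ; zero; suc; _+_)
open import Data.Bool using (Bool; true; false)
open import Data.List using (List; []; _∷_; concatMap)
open import Data.Fin using (Fin; toℕ)
open import Data.Vec using (Vec; tabulate)
open import Data.Product using (Σ; ∃; _×_)
open import Relation.Binary.PropositionalEquality using (_≡_)

data Letter : Set where
  a b c d : Letter

-- Fibonacci morphism on {0,1} (true = 1, false = 0): 1 ↦ 10, 0 ↦ 1
φ : Bool → List Bool
φ true  = true ∷ false ∷ []
φ false = true ∷ []

φ-iter : ℕ → List Bool
φ-iter zero    = true ∷ []
φ-iter (suc n) = concatMap φ (φ-iter n)

nth : List Bool → ℕ → Bool
nth []       _       = false
nth (y ∷ ys) zero    = y
nth (y ∷ ys) (suc n) = nth ys n

-- The infinite Fibonacci word x = 101101011..., 0-indexed: fib i = x_{i+1}.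
-- φⁿ(1) is a prefix of φⁿ⁺¹(1) and has length ≥ n+1, so entry i of
-- φ^(i+1)(1) is the i-th letter of the fixed point.
fib : ℕ → Bool
fib i = nth (φ-iter (suc i)) i

letter : Bool → Bool → Letter
letter true  true  = d
letter true  false = c
letter false true  = b
letter false false = a

-- The 2D Fibonacci word, 0-indexed: f2 i j = f(i+1, j+1)
f2 : ℕ → ℕ → Letter
f2 i j = letter (fib i) (fib j)

Array : ℕ → ℕ → Set
Array k l = Vec (Vec Letter l) k

-- The block in (1-based) rows i+1..i+k and columns j+1..j+l
block : (k l : ℕ) → ℕ → ℕ → Array k l
block k l i j = tabulate (λ r → tabulate (λ s → f2 (i + toℕ r) (j + toℕ s)))

IsFactor : (k l : ℕ) → Array k l → Set
IsFactor k l w = Σ ℕ (λ i → Σ ℕ (λ j → block k l i j ≡ w))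

{-# OPTIONS --safe #-}
module Submission where

-- Since f(i, j) = letter x_i x_j, a k × l block of the 2D word determines and is determined
-- by the pair of factors x[i, i+k) and x[j, j+l) of the 1D Fibonacci word x, so there are
-- p(k) p(l) blocks, where p is the factor complexity of x.  p(n) = n + 1 because, for every n,
-- the prefix of length n is the only left special factor of x: it occurs preceded by both
-- letters, and if a factor occurs preceded by both letters, then desubstituting through
-- x = φ(x) gives a shorter factor with the same property, whose φ-image is a prefix of x.
-- Hence passing from length n to n + 1 adds exactly one factor.

open import Defs
open import Function using (_∘_)
open import Data.Nat using (ℕ; zero; suc; pred; _+_; _*_; _∸_; _≤_; _<_; _≤′_; ≤′-refl; ≤′-step; z≤n; s≤s; z<s; s≤s⁻¹)
open import Data.Nat.Properties
open import Data.Nat.Induction using (<-rec)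
open import Data.Bool using (Bool; true; false; not)
open import Data.Bool.Properties using (not-involutive) renaming (_≟_ to _≟ᵇ_)
open import Data.Fin using (toℕ; fromℕ<)
open import Data.Fin.Properties using (toℕ<n; toℕ-fromℕ<)
open import Data.Vec as Vec using (Vec; []; _∷_; tabulate; head; tail; lookup)
open import Data.Vec.Properties using (≡-dec; tabulate-∘; tabulate-cong; lookup∘tabulate)
open import Data.List using (List; []; _∷_; _++_; length; map; concatMap; cartesianProductWith)
open import Data.List.Properties using (concatMap-++; map-concatMap; length-++; length-map; ++-assoc; ++-identityʳ)
open import Data.List.Relation.Unary.All as All using (All; []; _∷_)
open import Data.List.Relation.Unary.AllPairs using ([]; _∷_)
open import Data.List.Relation.Unary.Any using (here; there)
open import Data.List.Relation.Unary.Unique.Propositional using (Unique)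
open import Data.List.Relation.Unary.Unique.Propositional.Properties using (++⁺; cartesianProductWith⁺)
open import Data.List.Relation.Binary.Disjoint.Propositional using (Disjoint)
open import Data.List.Membership.Propositional using (_∈_; _∉_; find; lose)
open import Data.List.Membership.Propositional.Properties
  using (∈-map⁺; ∈-map⁻; ∈-concatMap⁺; ∈-concatMap⁻; ∈-cartesianProductWith⁺; ∈-cartesianProductWith⁻)
open import Data.Product using (Σ; Σ-syntax; ∃-syntax; ∃₂; _×_; _,_; proj₁; proj₂)
open import Data.Sum using (_⊎_; inj₁; inj₂)
open import Data.Empty using (⊥-elim)
open import Relation.Nullary using (Dec; yes; no; contradiction)
open import Relation.Binary.PropositionalEquality

module Windows {A : Set} (w : ℕ → A) where

  window : (n : ℕ) → ℕ → Vec A n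
  window zero    i = []
  window (suc n) i = w i ∷ window n (suc i)

  window-tabulate : ∀ n i → window n i ≡ tabulate (λ r → w (i + toℕ r))
  window-tabulate zero    i = refl
  window-tabulate (suc n) i = cong₂ _∷_ (cong w (sym (+-identityʳ i)))
    (trans (window-tabulate n (suc i)) (tabulate-cong (λ r → cong w (sym (+-suc i (toℕ r))))))

  record Agree (n i j : ℕ) : Set where
    constructor agree
    field at : ∀ t → t < n → w (i + t) ≡ w (j + t)

  open Agree public

  agree⇒window≡ : ∀ n {i j} → Agree n i j → window n i ≡ window n j
  agree⇒window≡ n {i} {j} ag = begin
    window n i                      ≡⟨ window-tabulate n i ⟩
    tabulate (λ r → w (i + toℕ r)) ≡⟨ tabulate-cong (λ r → at ag (toℕ r) (toℕ<n r)) ⟩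
    tabulate (λ r → w (j + toℕ r)) ≡⟨ window-tabulate n j ⟨
    window n j                      ∎
    where open ≡-Reasoning

  lookup-window : ∀ n i {t} (t<n : t < n) → lookup (window n i) (fromℕ< t<n) ≡ w (i + t)
  lookup-window n i t<n = trans (cong (λ v → lookup v (fromℕ< t<n)) (window-tabulate n i))
    (trans (lookup∘tabulate _ (fromℕ< t<n)) (cong (λ s → w (i + s)) (toℕ-fromℕ< t<n)))

  window≡⇒agree : ∀ n {i j} → window n i ≡ window n j → Agree n i j
  window≡⇒agree n {i} {j} eq = agree λ t t<n → trans (sym (lookup-window n i t<n))
    (trans (cong (λ v → lookup v (fromℕ< t<n)) eq) (lookup-window n j t<n))

  agree-head : ∀ {n i j} → Agree (suc n) i j → w i ≡ w j
  agree-head {i = i} {j} ag = trans (cong w (sym (+-identityʳ i))) (trans (at ag 0 z<s) (cong w (+-identityʳ j)))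

  agree-≤ : ∀ {m n i j} → m ≤ n → Agree n i j → Agree m i j
  agree-≤ m≤n ag = agree λ t t<m → at ag t (<-≤-trans t<m m≤n)

  agree-snoc : ∀ {n i j} → Agree n i j → w (i + n) ≡ w (j + n) → Agree (suc n) i j
  agree-snoc {n} {i} {j} ag last = agree extended
    where
      extended : ∀ t → t < suc n → w (i + t) ≡ w (j + t)
      extended t t<1+n with m≤n⇒m<n∨m≡n (s≤s⁻¹ t<1+n)
      ... | inj₁ t<n  = at ag t t<n
      ... | inj₂ refl = last

  agree-++ : ∀ {m n i j} → Agree m i j → Agree n (i + m) (j + m) → Agree (m + n) i j
  agree-++ {m} {n} {i} {j} ag₁ ag₂ = agree joined
    where
      joined : ∀ t → t < m + n → w (i + t) ≡ w (j + t)
      joined t t<m+n with t <? m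
      ... | yes t<m = at ag₁ t t<m
      ... | no  t≮m = subst (λ s → w (i + s) ≡ w (j + s)) m+u≡t
        (trans (cong w (sym (+-assoc i m u)))
          (trans (at ag₂ u (+-cancelˡ-< m u n (subst (_< m + n) (sym m+u≡t) t<m+n))) (cong w (+-assoc j m u))))
        where
          u = t ∸ m
          m+u≡t : m + u ≡ t
          m+u≡t = m+[n∸m]≡n (≮⇒≥ t≮m)

concatMap-unique : ∀ {A B C : Set} (f : A → List B) (h : A → C) (g : B → C) →
                   (∀ x → All (λ y → g y ≡ h x) (f x)) → (∀ x → Unique (f x)) →
                   ∀ {xs} → Unique (map h xs) → Unique (concatMap f xs)
concatMap-unique f h g g≡h f-unique {[]}     _          = []
concatMap-unique f h g g≡h f-unique {x ∷ xs} (hx∉ ∷ hs) =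
  ++⁺ (f-unique x) (concatMap-unique f h g g≡h f-unique hs) disjoint
  where
    disjoint : Disjoint (f x) (concatMap f xs)
    disjoint (y∈fx , y∈rest) with find (∈-concatMap⁻ f y∈rest)
    ... | x′ , x′∈xs , y∈fx′ = All.lookup hx∉ (∈-map⁺ h x′∈xs)
      (trans (sym (All.lookup (g≡h x) y∈fx)) (All.lookup (g≡h x′) y∈fx′))

length-cartesianProductWith : ∀ {A B C : Set} (f : A → B → C) xs ys →
                              length (cartesianProductWith f xs ys) ≡ length xs * length ys
length-cartesianProductWith f []       ys = refl
length-cartesianProductWith f (x ∷ xs) ys = trans (length-++ (map (f x) ys))
  (cong₂ _+_ (length-map (f x) ys) (length-cartesianProductWith f xs ys))

module Complexity (w : ℕ → Bool) where

  open Windows w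

  factors : (n : ℕ) → List ℕ → List (Vec Bool n)
  factors n = map (window n)

  record Enumeration (n : ℕ) : Set where
    field
      starts   : List ℕ
      distinct : Unique (factors n starts)
      complete : ∀ i → window n i ∈ factors n starts

  open Enumeration public

  listing : ∀ {n} → Enumeration n → List (Vec Bool n)
  listing {n} E = factors n (starts E)

  PrefixIsUniqueLeftSpecial : ℕ → Set
  PrefixIsUniqueLeftSpecial n =
    (∀ x → ∃[ i ] w i ≡ x × window n (suc i) ≡ window n 0) ×
    (∀ i j → w i ≢ w j → window n (suc i) ≡ window n (suc j) → window n (suc i) ≡ window n 0)

  module Extension {n} (special : PrefixIsUniqueLeftSpecial n) where

    prefix : Vec Bool n
    prefix = window n 0

    _≟ᵥ_ : (u v : Vec Bool n) → Dec (u ≡ v)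
    _≟ᵥ_ = ≡-dec _≟ᵇ_

    occurrence : Bool → ℕ
    occurrence x = proj₁ (proj₁ special x)

    occurrence-letter : ∀ x → w (occurrence x) ≡ x
    occurrence-letter x = proj₁ (proj₂ (proj₁ special x))

    occurrence-window : ∀ x → window n (suc (occurrence x)) ≡ prefix
    occurrence-window x = proj₂ (proj₂ (proj₁ special x))

    -- Starts of the left extensions of the factor starting at q; q > 0 unless q is special.
    extensions : ℕ → List ℕ
    extensions q with window n q ≟ᵥ prefix
    ... | yes _ = occurrence false ∷ occurrence true ∷ []
    ... | no  _ = pred q ∷ []

    extensions-tail : ∀ q → All (λ v → tail v ≡ window n q) (factors (suc n) (extensions q))
    extensions-tail q with window n q ≟ᵥ prefix
    ... | yes q-special =
      trans (occurrence-window false) (sym q-special) ∷ trans (occurrence-window true) (sym q-special) ∷ []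
    extensions-tail zero    | no ¬special = ⊥-elim (¬special refl)
    extensions-tail (suc p) | no _        = refl ∷ []

    extensions-distinct : ∀ q → Unique (factors (suc n) (extensions q))
    extensions-distinct q with window n q ≟ᵥ prefix
    ... | yes _ = (letters-differ ∷ []) ∷ [] ∷ []
      where
        letters-differ : window (suc n) (occurrence false) ≢ window (suc n) (occurrence true)
        letters-differ eq = contradiction
          (trans (sym (occurrence-letter false)) (trans (cong head eq) (occurrence-letter true))) λ ()
    ... | no  _ = [] ∷ []

    extensions-cover : ∀ q i → window n (suc i) ≡ window n q → window (suc n) i ∈ factors (suc n) (extensions q)
    extensions-cover q i eq with window n q ≟ᵥ prefix
    ... | yes q-special = by-letter (w i)
      (cong₂ _∷_ (sym (occurrence-letter (w i))) (trans eq (trans q-special (sym (occurrence-window (w i))))))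
      where
        by-letter : ∀ x → window (suc n) i ≡ window (suc n) (occurrence x) →
                    window (suc n) i ∈ factors (suc n) (occurrence false ∷ occurrence true ∷ [])
        by-letter false e = here e
        by-letter true  e = there (here e)
    extensions-cover zero    i eq | no ¬special = ⊥-elim (¬special refl)
    extensions-cover (suc p) i eq | no ¬special with w i ≟ᵇ w p
    ... | yes same   = here (cong₂ _∷_ same eq)
    ... | no  differ = ⊥-elim (¬special (trans (sym eq) (proj₂ special i p differ eq)))

    length-extensions-nonspecial : ∀ {qs} → prefix ∉ factors n qs → length (concatMap extensions qs) ≡ length qs
    length-extensions-nonspecial {[]}     _       = refl
    length-extensions-nonspecial {q ∷ qs} prefix∉ with window n q ≟ᵥ prefix
    ... | yes q-special = ⊥-elim (prefix∉ (here (sym q-special)))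
    ... | no  _         = cong suc (length-extensions-nonspecial (prefix∉ ∘ there))

    length-extensions : ∀ {qs} → Unique (factors n qs) → prefix ∈ factors n qs →
                        length (concatMap extensions qs) ≡ suc (length qs)
    length-extensions {q ∷ qs} (q∉ ∷ _) _ with window n q ≟ᵥ prefix
    length-extensions {q ∷ qs} (q∉ ∷ _) _ | yes q-special =
      cong (suc ∘ suc) (length-extensions-nonspecial (λ prefix∈ → All.lookup q∉ prefix∈ q-special))
    length-extensions {q ∷ qs} _ (here eq) | no ¬special = ⊥-elim (¬special (sym eq))
    length-extensions {q ∷ qs} (_ ∷ distinct-qs) (there prefix∈) | no _ =
      cong suc (length-extensions distinct-qs prefix∈)

    extend : (E : Enumeration n) → Σ[ E′ ∈ Enumeration (suc n) ] length (starts E′) ≡ suc (length (starts E))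
    extend E = E′ , length-extensions (distinct E) (complete E 0)
      where
        new-factors : factors (suc n) (concatMap extensions (starts E)) ≡ concatMap (factors (suc n) ∘ extensions) (starts E)
        new-factors = map-concatMap (window (suc n)) extensions (starts E)

        cover : ∀ i → window (suc n) i ∈ factors (suc n) (concatMap extensions (starts E))
        cover i with ∈-map⁻ (window n) (complete E (suc i))
        ... | q , q∈ , eq = subst (_ ∈_) (sym new-factors)
          (∈-concatMap⁺ (factors (suc n) ∘ extensions) (lose q∈ (extensions-cover q i eq)))

        E′ : Enumeration (suc n)
        E′ = record
          { starts   = concatMap extensions (starts E)
          ; distinct = subst Unique (sym new-factors)
              (concatMap-unique (factors (suc n) ∘ extensions) (window n) tail
                extensions-tail extensions-distinct (distinct E))
          ; complete = cover
          }

  complexity : (∀ n → PrefixIsUniqueLeftSpecial n) → ∀ n → Σ[ E ∈ Enumeration n ] length (listing E) ≡ suc n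
  complexity special zero =
    record { starts = 0 ∷ [] ; distinct = [] ∷ [] ; complete = λ _ → here refl } , refl
  complexity special (suc n) with complexity special n
  ... | E , |E| with Extension.extend (special n) E
  ...   | E′ , |E′| = E′ , trans (length-map _ (starts E′))
    (trans |E′| (cong suc (trans (sym (length-map _ (starts E))) |E|)))

nth-++ˡ : ∀ (l r : List Bool) {i} → i < length l → nth (l ++ r) i ≡ nth l i
nth-++ˡ (y ∷ l) r {zero}  _         = refl
nth-++ˡ (y ∷ l) r {suc i} (s≤s i<l) = nth-++ˡ l r i<l

nth-++ʳ : ∀ (l r : List Bool) i → nth (l ++ r) (length l + i) ≡ nth r i
nth-++ʳ []      r i = refl
nth-++ʳ (y ∷ l) r i = nth-++ʳ l r i

φ-iter-grows : ∀ m → ∃₂ λ y R → φ-iter (suc m) ≡ φ-iter m ++ y ∷ R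
φ-iter-grows zero = false , [] , refl
φ-iter-grows (suc m) with φ-iter-grows m
... | true  , R , eq = true , false ∷ concatMap φ R , trans (cong (concatMap φ) eq) (concatMap-++ φ (φ-iter m) _)
... | false , R , eq = true , concatMap φ R , trans (cong (concatMap φ) eq) (concatMap-++ φ (φ-iter m) _)

φ-iter-prefix : ∀ {m m′} → m ≤′ m′ → ∃[ R ] φ-iter m′ ≡ φ-iter m ++ R
φ-iter-prefix ≤′-refl = [] , sym (++-identityʳ _)
φ-iter-prefix {m} (≤′-step {m′} m≤′m′) with φ-iter-prefix m≤′m′ | φ-iter-grows m′
... | R , eq | y , R′ , eq′ =
  R ++ y ∷ R′ , trans eq′ (trans (cong (_++ y ∷ R′) eq) (++-assoc (φ-iter m) R _))

<-length-φ-iter : ∀ m → m < length (φ-iter m)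
<-length-φ-iter zero = z<s
<-length-φ-iter (suc m) with φ-iter-grows m
... | y , R , eq = begin-strict
  suc m                                  ≤⟨ <-length-φ-iter m ⟩
  length (φ-iter m)                      <⟨ m<m+n _ z<s ⟩
  length (φ-iter m) + length (y ∷ R)     ≡⟨ length-++ (φ-iter m) ⟨
  length (φ-iter m ++ y ∷ R)             ≡⟨ cong length eq ⟨
  length (φ-iter (suc m))                ∎
  where open ≤-Reasoning

fib-nth-φ-iter : ∀ {m i} → i < m → fib i ≡ nth (φ-iter m) i
fib-nth-φ-iter {m} {i} i<m with φ-iter-prefix (≤⇒≤′ i<m)
... | R , eq = sym (trans (cong (λ l → nth l i) eq)
  (nth-++ˡ (φ-iter (suc i)) R (<-trans (n<1+n i) (<-length-φ-iter (suc i)))))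

imageLength : (ℕ → Bool) → ℕ → ℕ → ℕ
imageLength g α zero    = 0
imageLength g α (suc t) = imageLength g α t + length (φ (g (α + t)))

imageLength-cong : ∀ {g h α β} t → (∀ s → s < t → g (α + s) ≡ h (β + s)) →
                   imageLength g α t ≡ imageLength h β t
imageLength-cong zero    _  = refl
imageLength-cong (suc t) eq = cong₂ _+_ (imageLength-cong t (λ s s<t → eq s (m<n⇒m<1+n s<t)))
  (cong (length ∘ φ) (eq t (n<1+n t)))

imageLength-+ : ∀ g β α t → imageLength g β (α + t) ≡ imageLength g β α + imageLength g (β + α) t
imageLength-+ g β α zero    = trans (cong (imageLength g β) (+-identityʳ α)) (sym (+-identityʳ _))
imageLength-+ g β α (suc t) = begin
  imageLength g β (α + suc t)
    ≡⟨ cong (imageLength g β) (+-suc α t) ⟩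
  imageLength g β (α + t) + length (φ (g (β + (α + t))))
    ≡⟨ cong₂ _+_ (imageLength-+ g β α t) (cong (length ∘ φ ∘ g) (sym (+-assoc β α t))) ⟩
  imageLength g β α + imageLength g (β + α) t + length (φ (g (β + α + t)))
    ≡⟨ +-assoc (imageLength g β α) _ _ ⟩
  imageLength g β α + imageLength g (β + α) (suc t) ∎
  where open ≡-Reasoning

1≤length-φ : ∀ x → 1 ≤ length (φ x)
1≤length-φ true  = s≤s z≤n
1≤length-φ false = s≤s z≤n

imageLength-<-suc : ∀ g α t → imageLength g α t < imageLength g α (suc t)
imageLength-<-suc g α t = m<m+n _ (1≤length-φ (g (α + t)))

t≤imageLength : ∀ g α t → t ≤ imageLength g α t
t≤imageLength g α zero    = z≤n
t≤imageLength g α (suc t) = <-≤-trans (s≤s (t≤imageLength g α t)) (imageLength-<-suc g α t)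

nth-concatMap-φ : ∀ l j u → j < length l → u < length (φ (nth l j)) →
                  nth (concatMap φ l) (imageLength (nth l) 0 j + u) ≡ nth (φ (nth l j)) u
nth-concatMap-φ (y ∷ l) zero    u _         u< = nth-++ˡ (φ y) (concatMap φ l) u<
nth-concatMap-φ (y ∷ l) (suc j) u (s≤s j<l) u< = begin
  nth (φ y ++ concatMap φ l) (imageLength (nth (y ∷ l)) 0 (suc j) + u)
    ≡⟨ cong (λ p → nth (φ y ++ concatMap φ l) (p + u)) first-block ⟩
  nth (φ y ++ concatMap φ l) (length (φ y) + imageLength (nth l) 0 j + u)
    ≡⟨ cong (nth (φ y ++ concatMap φ l)) (+-assoc (length (φ y)) _ u) ⟩
  nth (φ y ++ concatMap φ l) (length (φ y) + (imageLength (nth l) 0 j + u))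
    ≡⟨ nth-++ʳ (φ y) (concatMap φ l) _ ⟩
  nth (concatMap φ l) (imageLength (nth l) 0 j + u)
    ≡⟨ nth-concatMap-φ l j u j<l u< ⟩
  nth (φ (nth l j)) u ∎
  where
    open ≡-Reasoning
    first-block : imageLength (nth (y ∷ l)) 0 (suc j) ≡ length (φ y) + imageLength (nth l) 0 j
    first-block = trans (imageLength-+ (nth (y ∷ l)) 0 1 j)
      (cong (length (φ y) +_) (imageLength-cong j (λ _ _ → refl)))

-- Since x = φ(x), x is the concatenation of the blocks φ(x_j); φ(x_j) starts at blockStart j.
blockStart : ℕ → ℕ
blockStart = imageLength fib 0

blockStart-+ : ∀ α t → blockStart (α + t) ≡ blockStart α + imageLength fib α t
blockStart-+ = imageLength-+ fib 0

blockStart-suc-true : ∀ j → fib j ≡ true → blockStart (suc j) ≡ suc (suc (blockStart j))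
blockStart-suc-true j eq = trans (cong (λ x → blockStart j + length (φ x)) eq) (+-comm (blockStart j) 2)

blockStart-suc-false : ∀ j → fib j ≡ false → blockStart (suc j) ≡ suc (blockStart j)
blockStart-suc-false j eq = trans (cong (λ x → blockStart j + length (φ x)) eq) (+-comm (blockStart j) 1)

fib-blockStart-+ : ∀ j u → u < length (φ (fib j)) → fib (blockStart j + u) ≡ nth (φ (fib j)) u
fib-blockStart-+ j u u< = begin
  fib (blockStart j + u)
    ≡⟨ fib-nth-φ-iter {suc m} (m<n⇒m<1+n (n<1+n _)) ⟩
  nth (concatMap φ l) (blockStart j + u)
    ≡⟨ cong (λ p → nth (concatMap φ l) (p + u)) (imageLength-cong j (λ s s<j → fib-nth-φ-iter (<-trans s<j j<m))) ⟩
  nth (concatMap φ l) (imageLength (nth l) 0 j + u)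
    ≡⟨ nth-concatMap-φ l j u (<-trans j<m (<-length-φ-iter m)) (subst (λ x → u < length (φ x)) fib-j u<) ⟩
  nth (φ (nth l j)) u
    ≡⟨ cong (λ x → nth (φ x) u) fib-j ⟨
  nth (φ (fib j)) u ∎
  where
    open ≡-Reasoning
    m = suc (blockStart j + u)
    l = φ-iter m
    j<m : j < m
    j<m = s≤s (≤-trans (t≤imageLength fib 0 j) (m≤m+n _ u))
    fib-j : fib j ≡ nth l j
    fib-j = fib-nth-φ-iter j<m

fib-blockStart : ∀ j → fib (blockStart j) ≡ true
fib-blockStart j = trans (cong fib (sym (+-identityʳ (blockStart j))))
  (trans (fib-blockStart-+ j 0 (1≤length-φ (fib j))) (nth-φ-0 (fib j)))
  where
    nth-φ-0 : ∀ x → nth (φ x) 0 ≡ true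
    nth-φ-0 true  = refl
    nth-φ-0 false = refl

fib-suc-blockStart : ∀ j → fib (suc (blockStart j)) ≡ not (fib j)
fib-suc-blockStart j with fib j in eq
... | true  = begin
  fib (suc (blockStart j)) ≡⟨ cong fib (+-comm 1 (blockStart j)) ⟩
  fib (blockStart j + 1)   ≡⟨ fib-blockStart-+ j 1 (subst (λ x → 1 < length (φ x)) (sym eq) ≤-refl) ⟩
  nth (φ (fib j)) 1        ≡⟨ cong (λ x → nth (φ x) 1) eq ⟩
  false                    ∎
  where open ≡-Reasoning
... | false = trans (cong fib (sym (blockStart-suc-false j eq))) (fib-blockStart (suc j))

position-cases : ∀ i → (∃[ j ] blockStart j ≡ i) ⊎ (∃[ j ] fib j ≡ true × suc (blockStart j) ≡ i)
position-cases zero = inj₁ (0 , refl)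
position-cases (suc i) with position-cases i
... | inj₂ (j , fib-j , refl) = inj₁ (suc j , blockStart-suc-true j fib-j)
... | inj₁ (j , refl) with fib j in eq
...   | true  = inj₂ (j , eq , refl)
...   | false = inj₁ (suc j , blockStart-suc-false j eq)

fib-true⇒blockStart : ∀ i → fib i ≡ true → ∃[ j ] blockStart j ≡ i
fib-true⇒blockStart i fib-i with position-cases i
... | inj₁ found = found
... | inj₂ (j , fib-j , refl) =
  contradiction (trans (sym fib-i) (trans (fib-suc-blockStart j) (cong not fib-j))) λ ()

fib-false⇒fib-suc : ∀ i → fib i ≡ false → fib (suc i) ≡ true
fib-false⇒fib-suc i fib-i with position-cases i
... | inj₁ (j , refl) = contradiction (trans (sym (fib-blockStart j)) fib-i) λ ()
... | inj₂ (j , fib-j , refl) = trans (cong fib (sym (blockStart-suc-true j fib-j))) (fib-blockStart (suc j))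

block-end : ∀ j → ∃[ i ] suc i ≡ blockStart (suc j) × fib i ≡ not (fib j)
block-end j = by-letter (fib j) refl
  where
    by-letter : ∀ x → fib j ≡ x → ∃[ i ] suc i ≡ blockStart (suc j) × fib i ≡ not (fib j)
    by-letter true  eq = suc (blockStart j) , sym (blockStart-suc-true j eq) , fib-suc-blockStart j
    by-letter false eq = blockStart j , sym (blockStart-suc-false j eq) , trans (fib-blockStart j) (cong not (sym eq))

preceding-block : ∀ i → fib (suc i) ≡ true → ∃[ j ] blockStart (suc j) ≡ suc i × fib i ≡ not (fib j)
preceding-block i fib-suc-i with fib-true⇒blockStart (suc i) fib-suc-i
... | suc j , start≡ with block-end j
...   | i′ , suc-i′≡ , fib-i′ =
  j , start≡ , subst (λ k → fib k ≡ not (fib j)) (suc-injective (trans suc-i′≡ start≡)) fib-i′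

open Windows fib

block-agree : ∀ i j → fib i ≡ fib j → Agree (length (φ (fib i))) (blockStart i) (blockStart j)
block-agree i j eq = agree λ u u< → begin
  fib (blockStart i + u) ≡⟨ fib-blockStart-+ i u u< ⟩
  nth (φ (fib i)) u      ≡⟨ cong (λ x → nth (φ x) u) eq ⟩
  nth (φ (fib j)) u      ≡⟨ fib-blockStart-+ j u (subst (λ x → u < length (φ x)) eq u<) ⟨
  fib (blockStart j + u) ∎
  where open ≡-Reasoning

imageLength-agree : ∀ {t α β} → Agree t α β → imageLength fib α t ≡ imageLength fib β t
imageLength-agree {t} ag = imageLength-cong t (at ag)

image-agree : ∀ t {α β} → Agree t α β → Agree (imageLength fib α t) (blockStart α) (blockStart β)
image-agree zero    _  = agree λ _ ()
image-agree (suc t) {α} {β} ag = agree-++ (image-agree t earlier)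
  (subst₂ (Agree _) (blockStart-+ α t) (trans (blockStart-+ β t) (cong (blockStart β +_) (sym (imageLength-agree earlier))))
    (block-agree (α + t) (β + t) (at ag t (n<1+n t))))
  where
    earlier : Agree t α β
    earlier = agree-≤ (n≤1+n t) ag

image-agree-suc : ∀ t {α β} → Agree t α β → Agree (suc (imageLength fib α t)) (blockStart α) (blockStart β)
image-agree-suc t {α} {β} ag = agree-snoc (image-agree t ag) (begin
  fib (blockStart α + imageLength fib α t) ≡⟨ cong fib (blockStart-+ α t) ⟨
  fib (blockStart (α + t))                 ≡⟨ fib-blockStart (α + t) ⟩
  true                                     ≡⟨ fib-blockStart (β + t) ⟨
  fib (blockStart (β + t))                 ≡⟨ cong fib (blockStart-+ β t) ⟩
  fib (blockStart β + imageLength fib β t) ≡⟨ cong (λ d → fib (blockStart β + d)) (imageLength-agree ag) ⟨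
  fib (blockStart β + imageLength fib α t) ∎)
  where open ≡-Reasoning

letter-from-image : ∀ j → fib j ≡ not (fib (suc (blockStart j)))
letter-from-image j = trans (sym (not-involutive (fib j))) (cong not (sym (fib-suc-blockStart j)))

-- x_{α+s} is determined by the letter right after the start of its block, so agreement of
-- the images up to those positions forces agreement of the preimages.
preimage-agree : ∀ {n α β} t → Agree n (blockStart α) (blockStart β) →
                 (∀ s → s < t → suc (imageLength fib α s) < n) → Agree t α β
preimage-agree zero    _  _ = agree λ _ ()
preimage-agree {n} {α} {β} (suc t) ag inside = agree-snoc earlier (begin
  fib (α + t)                                         ≡⟨ letter-from-image (α + t) ⟩
  not (fib (suc (blockStart (α + t))))                ≡⟨ cong (not ∘ fib) (after-start α) ⟩
  not (fib (blockStart α + suc (imageLength fib α t))) ≡⟨ cong not (at ag _ (inside t (n<1+n t))) ⟩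
  not (fib (blockStart β + suc (imageLength fib α t))) ≡⟨ cong (λ d → not (fib (blockStart β + suc d))) (imageLength-agree earlier) ⟩
  not (fib (blockStart β + suc (imageLength fib β t))) ≡⟨ cong (not ∘ fib) (after-start β) ⟨
  not (fib (suc (blockStart (β + t))))                ≡⟨ letter-from-image (β + t) ⟨
  fib (β + t)                                         ∎)
  where
    open ≡-Reasoning
    earlier : Agree t α β
    earlier = preimage-agree t ag (λ s s<t → inside s (m<n⇒m<1+n s<t))
    after-start : ∀ γ → suc (blockStart (γ + t)) ≡ blockStart γ + suc (imageLength fib γ t)
    after-start γ = trans (cong suc (blockStart-+ γ t)) (sym (+-suc (blockStart γ) _))

≢⇒≡false⊎≡false : ∀ {x y : Bool} → x ≢ y → x ≡ false ⊎ y ≡ false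
≢⇒≡false⊎≡false {false}         _   = inj₁ refl
≢⇒≡false⊎≡false {true}  {false} _   = inj₂ refl
≢⇒≡false⊎≡false {true}  {true}  x≢y = contradiction refl x≢y

least-reaching : (f : ℕ → ℕ) → (∀ s → f s < f (suc s)) →
                 ∀ n → ∃[ t ] (∀ s → s < t → f s < n) × n ≤ f t
least-reaching f f-increasing zero = 0 , (λ _ ()) , z≤n
least-reaching f f-increasing (suc n) with least-reaching f f-increasing n
... | t , below , n≤ft with m≤n⇒m<n∨m≡n n≤ft
...   | inj₁ n<ft = t , (λ s s<t → m<n⇒m<1+n (below s s<t)) , n<ft
...   | inj₂ refl = suc t , below-next , f-increasing t
  where
    below-next : ∀ s → s < suc t → f s < suc (f t)
    below-next s s<1+t with m≤n⇒m<n∨m≡n (s≤s⁻¹ s<1+t)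
    ... | inj₁ s<t  = m<n⇒m<1+n (below s s<t)
    ... | inj₂ refl = n<1+n (f s)

desubstitution : ∀ n J J′ → Agree (suc n) (blockStart J) (blockStart J′) →
                 ∃[ t ] t < suc n × Agree t J J′ × suc n ≤ suc (imageLength fib J t)
desubstitution n J J′ ag
  with least-reaching (suc ∘ imageLength fib J) (λ s → s≤s (imageLength-<-suc fib J s)) (suc n)
... | t , inside , reach = t , shorter t inside , preimage-agree t ag inside , reach
  where
    shorter : ∀ t → (∀ s → s < t → suc (imageLength fib J s) < suc n) → t < suc n
    shorter zero     _      = z<s
    shorter (suc t′) inside = ≤-<-trans (s≤s (t≤imageLength fib J t′)) (inside t′ (n<1+n t′))

fib-suc-after-distinct : ∀ i i′ → fib i ≢ fib i′ → fib (suc i) ≡ fib (suc i′) → fib (suc i) ≡ true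
fib-suc-after-distinct i i′ differ same with ≢⇒≡false⊎≡false differ
... | inj₁ fib-i  = fib-false⇒fib-suc i fib-i
... | inj₂ fib-i′ = trans same (fib-false⇒fib-suc i′ fib-i′)

LeftSpecialIsPrefix : ℕ → Set
LeftSpecialIsPrefix n = ∀ i i′ → fib i ≢ fib i′ → Agree n (suc i) (suc i′) → Agree n (suc i) 0

-- Both occurrences start a φ-block preceded by different letters; desubstituting gives a
-- shorter left special factor, which is a prefix by induction, and its image covers the window.
left-special-is-prefix : ∀ n → LeftSpecialIsPrefix n
left-special-is-prefix = <-rec LeftSpecialIsPrefix step
  where
  step : ∀ n → (∀ {m} → m < n → LeftSpecialIsPrefix m) → LeftSpecialIsPrefix n
  step zero    _  i i′ _      _  = agree λ _ ()
  step (suc n) ih i i′ differ ag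
    with fib-suc-after-distinct i i′ differ (agree-head ag)
  ... | fib-suc-i with preceding-block i fib-suc-i | preceding-block i′ (trans (sym (agree-head ag)) fib-suc-i)
  ... | j , start≡ , fib-i | j′ , start≡′ , fib-i′
    with desubstitution n (suc j) (suc j′) (subst₂ (Agree (suc n)) (sym start≡) (sym start≡′) ag)
  ... | t , t<n , blocks-agree , covers = subst (λ k → Agree (suc n) k 0) start≡
    (agree-≤ covers (image-agree-suc t (ih t<n j j′ letters-differ blocks-agree)))
    where
      letters-differ : fib j ≢ fib j′
      letters-differ eq = differ (trans fib-i (trans (cong not eq) (sym fib-i′)))

prefix-left-extension : ∀ n x → ∃[ i ] fib i ≡ x × Agree n (suc i) 0
prefix-left-extension zero true  = 0 , refl , agree λ _ ()
prefix-left-extension zero false = 1 , refl , agree λ _ ()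
prefix-left-extension (suc n) x with prefix-left-extension n (not x)
... | j , fib-j , ag with block-end j
...   | i , suc-i≡ , fib-i = i , trans fib-i (trans (cong not fib-j) (not-involutive x)) ,
  subst (λ k → Agree (suc n) k 0) (sym suc-i≡)
    (agree-≤ (s≤s (t≤imageLength fib (suc j) n)) (image-agree-suc n ag))

open Complexity fib using (Enumeration; listing; distinct; complete; PrefixIsUniqueLeftSpecial; complexity)

fib-prefix-is-unique-left-special : ∀ n → PrefixIsUniqueLeftSpecial n
fib-prefix-is-unique-left-special n =
  (λ x → let i , fib-i , ag = prefix-left-extension n x in i , fib-i , agree⇒window≡ n ag) ,
  (λ i i′ differ eq → agree⇒window≡ n (left-special-is-prefix n i i′ differ (window≡⇒agree n eq)))

fib-complexity : ∀ n → Σ[ E ∈ Enumeration n ] length (listing E) ≡ suc n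
fib-complexity = complexity fib-prefix-is-unique-left-special

rowBit : Letter → Bool
rowBit a = false
rowBit b = false
rowBit c = true
rowBit d = true

columnBit : Letter → Bool
columnBit a = false
columnBit b = true
columnBit c = false
columnBit d = true

rowBit-letter : ∀ x y → rowBit (letter x y) ≡ x
rowBit-letter true  true  = refl
rowBit-letter true  false = refl
rowBit-letter false true  = refl
rowBit-letter false false = refl

columnBit-letter : ∀ x y → columnBit (letter x y) ≡ y
columnBit-letter true  true  = refl
columnBit-letter true  false = refl
columnBit-letter false true  = refl
columnBit-letter false false = refl

combine : ∀ {k l} → Vec Bool k → Vec Bool l → Array k l
combine u v = Vec.map (λ x → Vec.map (letter x) v) u

rows : ∀ {k l} → Array k (suc l) → Vec Bool k
rows = Vec.map (rowBit ∘ head)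

columns : ∀ {k l} → Array (suc k) l → Vec Bool l
columns = Vec.map columnBit ∘ head

rows-combine : ∀ {k l} (u : Vec Bool k) (v : Vec Bool (suc l)) → rows (combine u v) ≡ u
rows-combine []      _       = refl
rows-combine (x ∷ u) (y ∷ v) = cong₂ _∷_ (rowBit-letter x y) (rows-combine u (y ∷ v))

columns-combine : ∀ {k l} (u : Vec Bool (suc k)) (v : Vec Bool l) → columns (combine u v) ≡ v
columns-combine (x ∷ u) []      = refl
columns-combine (x ∷ u) (y ∷ v) = cong₂ _∷_ (columnBit-letter x y) (columns-combine (x ∷ u) v)

combine-injective : ∀ {k l} {u u′ : Vec Bool (suc k)} {v v′ : Vec Bool (suc l)} →
                    combine u v ≡ combine u′ v′ → u ≡ u′ × v ≡ v′
combine-injective {u = u} {u′} {v} {v′} eq =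
  trans (sym (rows-combine u v)) (trans (cong rows eq) (rows-combine u′ v′)) ,
  trans (sym (columns-combine u v)) (trans (cong columns eq) (columns-combine u′ v′))

block≡combine : ∀ k l i j → block k l i j ≡ combine (window k i) (window l j)
block≡combine k l i j = sym (begin
  combine (window k i) (window l j)
    ≡⟨ cong₂ combine (window-tabulate k i) (window-tabulate l j) ⟩
  combine (tabulate (λ r → fib (i + toℕ r))) (tabulate (λ s → fib (j + toℕ s)))
    ≡⟨ tabulate-∘ _ _ ⟨
  tabulate (λ r → Vec.map (letter (fib (i + toℕ r))) (tabulate (λ s → fib (j + toℕ s))))
    ≡⟨ tabulate-cong (λ r → sym (tabulate-∘ _ _)) ⟩
  block k l i j ∎)
  where open ≡-Reasoning

mainTheorem2 : (k l : ℕ) → 1 ≤ k → 1 ≤ l →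
    Σ (List (Array k l)) (λ L →
      Unique L × length L ≡ suc k * suc l ×
      ((w : Array k l) → (w ∈ L → IsFactor k l w) × (IsFactor k l w → w ∈ L)))
mainTheorem2 (suc k) (suc l) _ _ with fib-complexity (suc k) | fib-complexity (suc l)
... | R , |R| | C , |C| =
  blocks ,
  cartesianProductWith⁺ combine combine-injective (distinct R) (distinct C) ,
  trans (length-cartesianProductWith combine (listing R) (listing C)) (cong₂ _*_ |R| |C|) ,
  λ w → occurs w , listed w
  where
    blocks : List (Array (suc k) (suc l))
    blocks = cartesianProductWith combine (listing R) (listing C)

    occurs : ∀ w → w ∈ blocks → IsFactor (suc k) (suc l) w
    occurs w w∈ with ∈-cartesianProductWith⁻ combine (listing R) (listing C) w∈
    ... | u , v , u∈ , v∈ , refl with ∈-map⁻ (window (suc k)) u∈ | ∈-map⁻ (window (suc l)) v∈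
    ...   | i , _ , refl | j , _ , refl = i , j , block≡combine (suc k) (suc l) i j

    listed : ∀ w → IsFactor (suc k) (suc l) w → w ∈ blocks
    listed w (i , j , refl) = subst (_∈ blocks) (sym (block≡combine (suc k) (suc l) i j))
      (∈-cartesianProductWith⁺ combine (complete R i) (complete C j))
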